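{- There is an absolute constant $C>0$ such that for any integers $n \ge 2$ and $1 \le k \le n/2$ there exists a $k$-distinguisher $\bar S=(S_1,\dots,S_m)$ of subsets of $[n]$ with $m \le C k^2 \log n$.
   Context: Let $[n]=\{0,1,\dots,n-1\}$. For a sequence $\bar S=(S_1,\dots,S_m)$ of subsets of $[n]$, a set $A \subseteq [n]$ and $a \in A$, define $\mathrm{Hits}(a,A,\bar S) = \{ j : S_j \cap A = \{a\}\}$. The sequence $\bar S$ (of size $m$) is a $k$-distinguisher if there is a threshold value $\xi$ (which may depend on $k$) such that for every $A \subseteq [n]$ and every $a \in A$: if $|A| \le k$ then $|\mathrm{Hits}(a,A,\bar S)| > \xi$, and if $|A| \ge 2k$ then $|\mathrm{Hits}(a,A,\bar S)| < \xi$. Nothing is required when $k < |A| < 2k$. -}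

module Defs where

open import Data.Nat using (ℕ; _*_; _<_; _≤_)
open import Data.Bool using (Bool)
open import Data.Bool.Properties renaming (_≟_ to _≟ᵇ_)
open import Data.Fin using (Fin)
open import Data.Fin.Subset using (Subset; _∈_; _∩_; ⁅_⁆; ∣_∣)
open import Data.Vec using (tabulate)
open import Data.Vec.Properties using (≡-dec)
open import Relation.Nullary using (does)
open import Data.Product using (Σ; _×_)

_≟ˢ_ : ∀ {n} → (A B : Subset n) → _
_≟ˢ_ = ≡-dec _≟ᵇ_

Hits : ∀ {n m} → Fin n → Subset n → (Fin m → Subset n) → Subset m
Hits a A S = tabulate (λ j → does ((S j ∩ A) ≟ˢ ⁅ a ⁆))

-- S̄ = (S_1,…,S_m) is a k-distinguisher with threshold ξ = t/2 (t : ℕ).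
-- (Hit counts are naturals and ξ ≥ 0 wlog, so half-integer thresholds lose nothing.)
IsDistinguisherWith : ∀ {n m} → ℕ → ℕ → (Fin m → Subset n) → Set
IsDistinguisherWith {n} k t S =
  (A : Subset n) (a : Fin n) → a ∈ A →
    (∣ A ∣ ≤ k → t < 2 * ∣ Hits a A S ∣) ×
    (2 * k ≤ ∣ A ∣ → 2 * ∣ Hits a A S ∣ < t)

IsDistinguisher : ∀ {n m} → ℕ → (Fin m → Subset n) → Set
IsDistinguisher k S = Σ ℕ (λ t → IsDistinguisherWith k t S)

module Submission where

-- Theorem 4: k-distinguishers of size O(k² log n), by the probabilistic method,
-- with probabilities expressed as counts over explicit enumerations.
--
-- Write k = k' + 1 and n ≤ 2^ℓ.  A colouring h : [n] → [q] with q = 8k - 3 colours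
-- contributes its q colour classes as sets.  For a ∈ A the class of a meets A
-- exactly in {a} iff h isolates a from B = A ∖ {a} (no point of B has a's colour);
-- for random h this has probability (1 - 1/q)^|B|, which is ≥ 7/8 for |B| ≤ k - 1
-- and ≤ 16/19 for |B| = 2k - 1.  For 7M independent colourings (M = 128·J,
-- J = 4kℓ + 2), Chernoff bounds via exponential weights make each such test fail
-- (too few resp. too many isolations, with threshold 6M) with probability ≤ 2^(-J),
-- and a union bound over the < 2^J tests yields a family passing all of them.  Its
-- colour classes form a k-distinguisher (larger sets A reduce to |B| = 2k - 1 by
-- monotonicity) with 7·M·q ≤ 43008·k²·⌈log₂ n⌉ sets.

open import Defs
open import Data.Nat
open import Data.Nat.Properties
open import Data.Nat.Tactic.RingSolver using (solve-∀)
open import Algebra.Properties.CommutativeSemigroup *-commutativeSemigroup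
  using () renaming (interchange to *-interchange; x∙yz≈y∙xz to *-left-comm)
open import Algebra.Properties.CommutativeSemigroup +-commutativeSemigroup
  using () renaming (interchange to +-interchange)
open import Data.Nat.Logarithm using (⌈log₂_⌉; ⌈log₂⌉-mono-≤)
open import Data.Nat.Logarithm.Core using (⌈log2⌉)
open import Data.Nat.Induction using (<-wellFounded)
open import Induction.WellFounded using (Acc; acc)
open import Data.Bool using (Bool; true; false; not; _∧_; _∨_; T; if_then_else_)
open import Data.Bool.Properties using (∧-identityʳ; ∧-zeroʳ; T-∧; T-∨; T-not-≡) renaming (_≟_ to _≟ᵇ_)
open import Data.List using (List; []; _∷_; _++_; map; concatMap; length; allFin; cartesianProduct)
open import Data.List.Properties using (map-tabulate; length-tabulate)
open import Data.List.Relation.Unary.Any as Any using (here; there)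
open import Data.List.Membership.Propositional using () renaming (_∈_ to _∈ˡ_)
open import Data.List.Membership.Propositional.Properties using (∈-concatMap⁺; ∈-map⁺; ∈-allFin; ∈-cartesianProduct⁺)
open import Data.Vec using (Vec; []; _∷_; lookup; tabulate; concat)
import Data.Vec as Vec
open import Data.Vec.Properties using (tabulate∘lookup; tabulate-∘; []=⇒lookup; lookup⇒[]=)
open import Data.Fin using (Fin; zero; suc)
open import Data.Fin.Properties using () renaming (_≟_ to _≟ᶠ_)
open import Data.Fin.Subset using (Subset; ∣_∣; _∩_; ⁅_⁆; _⊆_) renaming (⊥ to ∅)
open import Data.Fin.Subset.Properties using (drop-∷-⊆; out⊆; s⊆s; ⊥⊆; ∣⊥∣≡0)
open import Data.Product using (Σ; ∃; _×_; _,_; proj₁; proj₂)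
open import Data.Sum using (_⊎_; inj₁; inj₂)
open import Data.Empty using (⊥-elim)
open import Data.Unit using (tt)
open import Function.Bundles using (Equivalence)
open Equivalence using (to; from)
open import Relation.Nullary using (does; ¬_)
open import Relation.Binary.PropositionalEquality

private variable
  A B : Set

χ : Bool → ℕ
χ true = 1
χ false = 0

χ-∧ : ∀ a b → χ (a ∧ b) ≡ χ a * χ b
χ-∧ true b = sym (+-identityʳ (χ b))
χ-∧ false b = refl

χ-not : ∀ a → χ (not a) + χ a ≡ 1
χ-not true = refl
χ-not false = refl

χ-mono : ∀ {b c} → (T b → T c) → χ b ≤ χ c
χ-mono {false} _ = z≤n
χ-mono {true} {true} _ = ≤-refl
χ-mono {true} {false} b⇒c = ⊥-elim (b⇒c tt)

χ-∨ : ∀ b c → χ (b ∨ c) ≤ χ b + χ c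
χ-∨ false c = ≤-refl
χ-∨ true c = s≤s z≤n

T-not∧ : ∀ {x c} → T (not x ∧ c) → x ≡ false × T c
T-not∧ t with to T-∧ t
... | not-x , c = to T-not-≡ not-x , c

∑ : List A → (A → ℕ) → ℕ
∑ [] f = 0
∑ (x ∷ xs) f = f x + ∑ xs f

syntax ∑ xs (λ x → e) = ∑[ x ← xs ] e

∑-++ : ∀ (xs ys : List A) f → ∑ (xs ++ ys) f ≡ ∑ xs f + ∑ ys f
∑-++ [] ys f = refl
∑-++ (x ∷ xs) ys f = trans (cong (f x +_) (∑-++ xs ys f)) (sym (+-assoc (f x) _ _))

∑-map : (g : A → B) (xs : List A) (f : B → ℕ) → ∑ (map g xs) f ≡ ∑[ x ← xs ] f (g x)
∑-map g [] f = refl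
∑-map g (x ∷ xs) f = cong (f (g x) +_) (∑-map g xs f)

∑-concatMap : (g : A → List B) (xs : List A) (f : B → ℕ) →
  ∑ (concatMap g xs) f ≡ ∑[ x ← xs ] ∑ (g x) f
∑-concatMap g [] f = refl
∑-concatMap g (x ∷ xs) f = trans (∑-++ (g x) (concatMap g xs) f) (cong (∑ (g x) f +_) (∑-concatMap g xs f))

∑-cartesianProduct : ∀ (xs : List A) (ys : List B) f →
  ∑ (cartesianProduct xs ys) f ≡ ∑[ x ← xs ] ∑[ y ← ys ] f (x , y)
∑-cartesianProduct [] ys f = refl
∑-cartesianProduct (x ∷ xs) ys f = trans (∑-++ (map (x ,_) ys) _ f)
  (cong₂ _+_ (∑-map (x ,_) ys f) (∑-cartesianProduct xs ys f))

∑-cong : ∀ (xs : List A) {f g : A → ℕ} → (∀ x → f x ≡ g x) → ∑ xs f ≡ ∑ xs g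
∑-cong [] e = refl
∑-cong (x ∷ xs) e = cong₂ _+_ (e x) (∑-cong xs e)

∑-mono : ∀ (xs : List A) {f g : A → ℕ} → (∀ x → f x ≤ g x) → ∑ xs f ≤ ∑ xs g
∑-mono [] e = z≤n
∑-mono (x ∷ xs) e = +-mono-≤ (e x) (∑-mono xs e)

∑-+ : ∀ (xs : List A) (f g : A → ℕ) → ∑[ x ← xs ] (f x + g x) ≡ ∑ xs f + ∑ xs g
∑-+ [] f g = refl
∑-+ (x ∷ xs) f g = trans (cong (f x + g x +_) (∑-+ xs f g)) (+-interchange (f x) (g x) _ _)

∑-*ˡ : ∀ (xs : List A) c f → ∑[ x ← xs ] (c * f x) ≡ c * ∑ xs f
∑-*ˡ [] c f = sym (*-zeroʳ c)
∑-*ˡ (x ∷ xs) c f = trans (cong (c * f x +_) (∑-*ˡ xs c f)) (sym (*-distribˡ-+ c (f x) (∑ xs f)))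

∑-*ʳ : ∀ (xs : List A) c f → ∑[ x ← xs ] (f x * c) ≡ ∑ xs f * c
∑-*ʳ xs c f = trans (∑-cong xs (λ x → *-comm (f x) c)) (trans (∑-*ˡ xs c f) (*-comm c _))

length≡∑1 : ∀ (xs : List A) → length xs ≡ ∑[ _ ← xs ] 1
length≡∑1 [] = refl
length≡∑1 (x ∷ xs) = cong suc (length≡∑1 xs)

∑-const : ∀ (xs : List A) c → ∑[ _ ← xs ] c ≡ length xs * c
∑-const xs c = trans (∑-cong xs (λ _ → sym (*-identityˡ c)))
                     (trans (∑-*ʳ xs c (λ _ → 1)) (cong (_* c) (sym (length≡∑1 xs))))

∑-zero : (ys : List B) → ∑[ _ ← ys ] 0 ≡ 0
∑-zero [] = refl
∑-zero (y ∷ ys) = ∑-zero ys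

∑-swap : (xs : List A) (ys : List B) (f : A → B → ℕ) →
  ∑[ x ← xs ] ∑ ys (f x) ≡ ∑[ y ← ys ] ∑[ x ← xs ] f x y
∑-swap [] ys f = sym (∑-zero ys)
∑-swap (x ∷ xs) ys f = trans (cong (∑ ys (f x) +_) (∑-swap xs ys f)) (sym (∑-+ ys (f x) _))

∑≡0⇒ : ∀ (xs : List A) f {x} → ∑ xs f ≡ 0 → x ∈ˡ xs → f x ≡ 0
∑≡0⇒ (y ∷ xs) f e (here refl) = m+n≡0⇒m≡0 (f y) e
∑≡0⇒ (y ∷ xs) f e (there p) = ∑≡0⇒ xs f (m+n≡0⇒n≡0 (f y) e) p

zero-or-≥length : ∀ (xs : List A) g → (∃ λ x → g x ≡ 0) ⊎ length xs ≤ ∑ xs g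
zero-or-≥length [] g = inj₂ z≤n
zero-or-≥length (x ∷ xs) g with g x in eq | zero-or-≥length xs g
... | zero  | _ = inj₁ (x , eq)
... | suc _ | inj₁ found = inj₁ found
... | suc v | inj₂ le = inj₂ (s≤s (≤-trans le (m≤n+m _ v)))

∑-allFin-suc : ∀ q (f : Fin (suc q) → ℕ) → ∑ (allFin (suc q)) f ≡ f zero + ∑[ x ← allFin q ] f (suc x)
∑-allFin-suc q f = cong (f zero +_)
  (trans (cong (λ l → ∑ l f) (sym (map-tabulate (λ x → x) suc))) (∑-map suc (allFin q) f))

length-allFin : ∀ q → length (allFin q) ≡ q
length-allFin q = length-tabulate (λ x → x)

vectors : (n : ℕ) → List A → List (Vec A n)
vectors zero xs = [] ∷ []
vectors (suc n) xs = concatMap (λ x → map (x ∷_) (vectors n xs)) xs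

∑-vectors-suc : ∀ n (xs : List A) (F : Vec A (suc n) → ℕ) →
  ∑ (vectors (suc n) xs) F ≡ ∑[ x ← xs ] ∑[ v ← vectors n xs ] F (x ∷ v)
∑-vectors-suc n xs F = trans (∑-concatMap _ xs F) (∑-cong xs (λ x → ∑-map (x ∷_) (vectors n xs) F))

∈-vectors : ∀ n (xs : List A) → (∀ x → x ∈ˡ xs) → (v : Vec A n) → v ∈ˡ vectors n xs
∈-vectors zero xs all [] = here refl
∈-vectors (suc n) xs all (x ∷ v) =
  ∈-concatMap⁺ _ (Any.map (λ { refl → ∈-map⁺ (x ∷_) (∈-vectors n xs all v) }) (all x))

bools : List Bool
bools = false ∷ true ∷ []

∈-bools : ∀ b → b ∈ˡ bools
∈-bools false = here refl
∈-bools true = there (here refl)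

∏ : ∀ {m} → (A → ℕ) → Vec A m → ℕ
∏ w [] = 1
∏ w (x ∷ v) = w x * ∏ w v

∑-∏ : ∀ m (xs : List A) (w : A → ℕ) → ∑ (vectors m xs) (∏ w) ≡ ∑ xs w ^ m
∑-∏ zero xs w = refl
∑-∏ (suc m) xs w = begin
  ∑ (vectors (suc m) xs) (∏ w)                        ≡⟨ ∑-vectors-suc m xs (∏ w) ⟩
  ∑[ x ← xs ] ∑[ v ← vectors m xs ] (w x * ∏ w v)     ≡⟨ ∑-cong xs (λ x → ∑-*ˡ (vectors m xs) (w x) (∏ w)) ⟩
  ∑[ x ← xs ] (w x * ∑ (vectors m xs) (∏ w))          ≡⟨ ∑-*ʳ xs _ w ⟩
  ∑ xs w * ∑ (vectors m xs) (∏ w)                     ≡⟨ cong (∑ xs w *_) (∑-∏ m xs w) ⟩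
  ∑ xs w * ∑ xs w ^ m                                 ∎
  where open ≡-Reasoning

length-vectors : ∀ m (xs : List A) → length (vectors m xs) ≡ length xs ^ m
length-vectors m xs = begin
  length (vectors m xs)             ≡⟨ length≡∑1 (vectors m xs) ⟩
  ∑[ v ← vectors m xs ] 1           ≡⟨ ∑-cong (vectors m xs) (λ v → sym (∏-one v)) ⟩
  ∑ (vectors m xs) (∏ (λ _ → 1))    ≡⟨ ∑-∏ m xs (λ _ → 1) ⟩
  ∑[ _ ← xs ] 1 ^ m                 ≡⟨ cong (_^ m) (sym (length≡∑1 xs)) ⟩
  length xs ^ m                     ∎
  where
  open ≡-Reasoning
  ∏-one : ∀ {k} (v : Vec _ k) → ∏ (λ _ → 1) v ≡ 1
  ∏-one [] = refl
  ∏-one (x ∷ v) = cong (_+ 0) (∏-one v)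

count : ∀ {m} → (A → Bool) → Vec A m → ℕ
count g [] = 0
count g (x ∷ v) = χ (g x) + count g v

count-+-count-not : ∀ {m} (g : A → Bool) (v : Vec A m) → count g v + count (λ x → not (g x)) v ≡ m
count-+-count-not g [] = refl
count-+-count-not g (x ∷ v) with g x
... | true = cong suc (count-+-count-not g v)
... | false = trans (+-suc (count g v) _) (cong suc (count-+-count-not g v))

count-mono : ∀ {m} (g g' : A → Bool) → (∀ x → T (g' x) → T (g x)) → (v : Vec A m) → count g' v ≤ count g v
count-mono g g' imp [] = z≤n
count-mono g g' imp (x ∷ v) with g' x | g x | imp x
... | true | true | _ = s≤s (count-mono g g' imp v)
... | true | false | i = ⊥-elim (i tt)
... | false | _ | _ = +-mono-≤ z≤n (count-mono g g' imp v)

card-map : ∀ {m} (g : A → Bool) (v : Vec A m) → ∣ Vec.map g v ∣ ≡ count g v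
card-map g [] = refl
card-map g (x ∷ v) with g x
... | true = cong suc (card-map g v)
... | false = card-map g v

count-++ : ∀ {k l} (g : A → Bool) (u : Vec A k) (v : Vec A l) → count g (u Vec.++ v) ≡ count g u + count g v
count-++ g [] v = refl
count-++ g (x ∷ u) v = trans (cong (χ (g x) +_) (count-++ g u v)) (sym (+-assoc (χ (g x)) _ _))

count-tabulate : ∀ {q} (g : A → Bool) (f : Fin q → A) → count g (tabulate f) ≡ ∑[ y ← allFin q ] χ (g (f y))
count-tabulate {q = zero} g f = refl
count-tabulate {q = suc q} g f = trans (cong (χ (g (f zero)) +_) (count-tabulate g (λ y → f (suc y))))
                                       (sym (∑-allFin-suc q (λ y → χ (g (f y)))))

-- Family.  A colouring of [n] with q = p + 1 colours is a vector h ∈ [q]ⁿ;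
-- its colour classes will be the sets of the distinguisher.  Colours are compared
-- by boolean equality.
_==_ : ∀ {q} → Fin q → Fin q → Bool
x == y = does (x ≟ᶠ y)

==-sym : ∀ {q} (x y : Fin q) → x == y ≡ y == x
==-sym zero zero = refl
==-sym zero (suc y) = refl
==-sym (suc x) zero = refl
==-sym (suc x) (suc y) = ==-sym x y

colourings : (p n : ℕ) → List (Vec (Fin (suc p)) n)
colourings p n = vectors n (allFin (suc p))

∑-select : ∀ q (z : Fin q) (P : Fin q → Bool) → ∑[ y ← allFin q ] χ (y == z ∧ P y) ≡ χ (P z)
∑-select (suc q) zero P = begin
  ∑[ y ← allFin (suc q) ] χ (y == zero ∧ P y)           ≡⟨ ∑-allFin-suc q _ ⟩
  χ (P zero) + ∑[ y ← allFin q ] 0                       ≡⟨ cong (χ (P zero) +_) (∑-zero (allFin q)) ⟩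
  χ (P zero) + 0                                         ≡⟨ +-identityʳ _ ⟩
  χ (P zero)                                             ∎
  where open ≡-Reasoning
∑-select (suc q) (suc z) P = trans (∑-allFin-suc q (λ y → χ (y == suc z ∧ P y))) (∑-select q z (λ y → P (suc y)))

∑-other-colours : ∀ p (z : Fin (suc p)) → ∑[ y ← allFin (suc p) ] χ (not (y == z)) ≡ p
∑-other-colours p z = +-cancelʳ-≡ 1 _ _ (begin
  ∑[ y ← ys ] χ (not (y == z)) + 1
    ≡⟨ cong (∑[ y ← ys ] χ (not (y == z)) +_) (sym one-match) ⟩
  ∑[ y ← ys ] χ (not (y == z)) + ∑[ y ← ys ] χ (y == z)
    ≡⟨ sym (∑-+ ys (λ y → χ (not (y == z))) (λ y → χ (y == z))) ⟩
  ∑[ y ← ys ] (χ (not (y == z)) + χ (y == z))   ≡⟨ ∑-cong ys (λ y → χ-not (y == z)) ⟩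
  ∑[ _ ← ys ] 1                                 ≡⟨ sym (length≡∑1 ys) ⟩
  length ys                                     ≡⟨ length-allFin (suc p) ⟩
  suc p                                         ≡⟨ +-comm 1 p ⟩
  p + 1                                         ∎)
  where
  open ≡-Reasoning
  ys : List (Fin (suc p))
  ys = allFin (suc p)
  one-match : ∑[ y ← ys ] χ (y == z) ≡ 1
  one-match = trans (∑-cong ys (λ y → cong χ (sym (∧-identityʳ (y == z))))) (∑-select (suc p) z (λ _ → true))

avoids : ∀ {q n} → Fin q → Subset n → Vec (Fin q) n → Bool
avoids y [] [] = true
avoids y (b ∷ B) (x ∷ h) = (not b ∨ not (x == y)) ∧ avoids y B h

isolates : ∀ {q n} → Fin n → Subset n → Vec (Fin q) n → Bool
isolates a B h = avoids (lookup h a) B h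

-- The number of colours available at a coordinate inside (p) or outside (p + 1) of B.
allowed : ℕ → Bool → ℕ
allowed p true = p
allowed p false = suc p

∑-allowed : ∀ p b (z : Fin (suc p)) → ∑[ x ← allFin (suc p) ] χ (not b ∨ not (x == z)) ≡ allowed p b
∑-allowed p true z = ∑-other-colours p z
∑-allowed p false z = trans (sym (length≡∑1 (allFin (suc p)))) (length-allFin (suc p))

avoid-count : ∀ p n (y : Fin (suc p)) (B : Subset n) →
  ∑[ h ← colourings p n ] χ (avoids y B h) ≡ ∏ (allowed p) B
avoid-count p zero y [] = refl
avoid-count p (suc n) y (b ∷ B) = begin
  ∑[ h ← colourings p (suc n) ] χ (avoids y (b ∷ B) h)
    ≡⟨ ∑-vectors-suc n (allFin (suc p)) _ ⟩
  ∑[ x ← allFin (suc p) ] ∑[ h ← colourings p n ] χ (c x ∧ avoids y B h)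
    ≡⟨ ∑-cong (allFin (suc p)) (λ x → trans (∑-cong (colourings p n) (λ h → χ-∧ (c x) _))
                                             (∑-*ˡ (colourings p n) (χ (c x)) _)) ⟩
  ∑[ x ← allFin (suc p) ] (χ (c x) * ∑[ h ← colourings p n ] χ (avoids y B h))
    ≡⟨ ∑-*ʳ (allFin (suc p)) _ (λ x → χ (c x)) ⟩
  ∑[ x ← allFin (suc p) ] χ (c x) * ∑[ h ← colourings p n ] χ (avoids y B h)
    ≡⟨ cong₂ _*_ (∑-allowed p b y) (avoid-count p n y B) ⟩
  allowed p b * ∏ (allowed p) B ∎
  where
  open ≡-Reasoning
  c : Fin (suc p) → Bool
  c x = not b ∨ not (x == y)

isolate-count : ∀ p n (a : Fin n) (B : Subset n) → lookup B a ≡ false →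
  ∑[ h ← colourings p n ] χ (isolates a B h) ≡ ∏ (allowed p) B
isolate-count p (suc n) zero (false ∷ B) _ = begin
  ∑[ h ← colourings p (suc n) ] χ (isolates zero (false ∷ B) h)
    ≡⟨ ∑-vectors-suc n (allFin (suc p)) _ ⟩
  ∑[ x ← allFin (suc p) ] ∑[ h ← colourings p n ] χ (avoids x B h)
    ≡⟨ ∑-cong (allFin (suc p)) (λ x → avoid-count p n x B) ⟩
  ∑[ _ ← allFin (suc p) ] ∏ (allowed p) B
    ≡⟨ ∑-const (allFin (suc p)) _ ⟩
  length (allFin (suc p)) * ∏ (allowed p) B
    ≡⟨ cong (_* ∏ (allowed p) B) (length-allFin (suc p)) ⟩
  suc p * ∏ (allowed p) B ∎
  where open ≡-Reasoning
isolate-count p (suc n) (suc a) (b ∷ B) a∉B = begin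
  ∑[ h ← colourings p (suc n) ] χ (isolates (suc a) (b ∷ B) h)
    ≡⟨ ∑-vectors-suc n (allFin (suc p)) _ ⟩
  ∑[ x ← allFin (suc p) ] ∑[ h ← colourings p n ] χ (c x (lookup h a) ∧ isolates a B h)
    ≡⟨ ∑-swap (allFin (suc p)) (colourings p n) _ ⟩
  ∑[ h ← colourings p n ] ∑[ x ← allFin (suc p) ] χ (c x (lookup h a) ∧ isolates a B h)
    ≡⟨ ∑-cong (colourings p n) (λ h → trans (∑-cong (allFin (suc p)) (λ x → χ-∧ (c x (lookup h a)) _))
                                            (∑-*ʳ (allFin (suc p)) _ (λ x → χ (c x (lookup h a))))) ⟩
  ∑[ h ← colourings p n ] (∑[ x ← allFin (suc p) ] χ (c x (lookup h a)) * χ (isolates a B h))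
    ≡⟨ ∑-cong (colourings p n) (λ h → cong (_* χ (isolates a B h)) (∑-allowed p b (lookup h a))) ⟩
  ∑[ h ← colourings p n ] (allowed p b * χ (isolates a B h))
    ≡⟨ ∑-*ˡ (colourings p n) (allowed p b) _ ⟩
  allowed p b * ∑[ h ← colourings p n ] χ (isolates a B h)
    ≡⟨ cong (allowed p b *_) (isolate-count p n a B a∉B) ⟩
  allowed p b * ∏ (allowed p) B ∎
  where
  open ≡-Reasoning
  c : Fin (suc p) → Fin (suc p) → Bool
  c x z = not b ∨ not (x == z)

∏-allowed : ∀ p {n} (B : Subset n) → ∏ (allowed p) B * suc p ^ ∣ B ∣ ≡ p ^ ∣ B ∣ * suc p ^ n
∏-allowed p [] = refl
∏-allowed p {suc n} (true ∷ B) = begin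
  p * W * (suc p * suc p ^ ∣ B ∣)     ≡⟨ *-interchange p W (suc p) (suc p ^ ∣ B ∣) ⟩
  p * suc p * (W * suc p ^ ∣ B ∣)     ≡⟨ cong (p * suc p *_) (∏-allowed p B) ⟩
  p * suc p * (p ^ ∣ B ∣ * suc p ^ n) ≡⟨ *-interchange p (suc p) (p ^ ∣ B ∣) (suc p ^ n) ⟩
  p * p ^ ∣ B ∣ * (suc p * suc p ^ n) ∎
  where
  open ≡-Reasoning
  W : ℕ
  W = ∏ (allowed p) B
∏-allowed p {suc n} (false ∷ B) = begin
  suc p * W * suc p ^ ∣ B ∣           ≡⟨ *-assoc (suc p) W _ ⟩
  suc p * (W * suc p ^ ∣ B ∣)         ≡⟨ cong (suc p *_) (∏-allowed p B) ⟩
  suc p * (p ^ ∣ B ∣ * suc p ^ n)     ≡⟨ *-left-comm (suc p) (p ^ ∣ B ∣) (suc p ^ n) ⟩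
  p ^ ∣ B ∣ * (suc p * suc p ^ n)     ∎
  where
  open ≡-Reasoning
  W : ℕ
  W = ∏ (allowed p) B

*-^-distrib : ∀ a b m → (a * b) ^ m ≡ a ^ m * b ^ m
*-^-distrib a b zero = refl
*-^-distrib a b (suc m) = trans (cong (a * b *_) (*-^-distrib a b m)) (*-interchange a b (a ^ m) (b ^ m))

markov : ∀ (xs : List A) m (w : A → ℕ) (bad : Vec A m → Bool) K →
  (∀ H → T (bad H) → K ≤ ∏ w H) → K * ∑[ H ← vectors m xs ] χ (bad H) ≤ ∑ xs w ^ m
markov xs m w bad K heavy = begin
  K * ∑[ H ← vectors m xs ] χ (bad H)     ≡⟨ sym (∑-*ˡ (vectors m xs) K (λ H → χ (bad H))) ⟩
  ∑[ H ← vectors m xs ] (K * χ (bad H))   ≤⟨ ∑-mono (vectors m xs) pointwise ⟩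
  ∑ (vectors m xs) (∏ w)                   ≡⟨ ∑-∏ m xs w ⟩
  ∑ xs w ^ m                               ∎
  where
  open ≤-Reasoning
  pointwise : ∀ H → K * χ (bad H) ≤ ∏ w H
  pointwise H with bad H | heavy H
  ... | true  | h = ≤-trans (≤-reflexive (*-identityʳ K)) (h tt)
  ... | false | _ = ≤-trans (≤-reflexive (*-zeroʳ K)) z≤n

chernoff : ∀ (xs : List A) M (w : A → ℕ) (bad : Vec A (7 * M) → Bool) (c u v d : ℕ) →
  (∀ H → T (bad H) → u ^ (6 * M) * v ^ M ≤ ∏ w H) → c * ∑ xs w ≤ d * length xs →
  (c ^ 7 * u ^ 6 * v) ^ M * ∑[ H ← vectors (7 * M) xs ] χ (bad H) ≤ (d ^ 7) ^ M * length xs ^ (7 * M)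
chernoff xs M w bad c u v d heavy average = begin
  (c ^ 7 * u ^ 6 * v) ^ M * S              ≡⟨ cong (_* S) per-block ⟩
  c ^ (7 * M) * (u ^ (6 * M) * v ^ M) * S  ≡⟨ *-assoc (c ^ (7 * M)) _ S ⟩
  c ^ (7 * M) * (u ^ (6 * M) * v ^ M * S)  ≤⟨ *-monoʳ-≤ (c ^ (7 * M)) (markov xs (7 * M) w bad _ heavy) ⟩
  c ^ (7 * M) * ∑ xs w ^ (7 * M)           ≡⟨ sym (*-^-distrib c (∑ xs w) (7 * M)) ⟩
  (c * ∑ xs w) ^ (7 * M)                   ≤⟨ ^-monoˡ-≤ (7 * M) average ⟩
  (d * length xs) ^ (7 * M)                ≡⟨ *-^-distrib d (length xs) (7 * M) ⟩
  d ^ (7 * M) * length xs ^ (7 * M)        ≡⟨ cong (_* length xs ^ (7 * M)) (sym (^-*-assoc d 7 M)) ⟩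
  (d ^ 7) ^ M * length xs ^ (7 * M)        ∎
  where
  open ≤-Reasoning
  S : ℕ
  S = ∑[ H ← vectors (7 * M) xs ] χ (bad H)
  per-block : (c ^ 7 * u ^ 6 * v) ^ M ≡ c ^ (7 * M) * (u ^ (6 * M) * v ^ M)
  per-block = begin-equality
    (c ^ 7 * u ^ 6 * v) ^ M              ≡⟨ *-^-distrib (c ^ 7 * u ^ 6) v M ⟩
    (c ^ 7 * u ^ 6) ^ M * v ^ M          ≡⟨ cong (_* v ^ M) (*-^-distrib (c ^ 7) (u ^ 6) M) ⟩
    (c ^ 7) ^ M * (u ^ 6) ^ M * v ^ M    ≡⟨ cong₂ (λ x y → x * y * v ^ M) (^-*-assoc c 7 M) (^-*-assoc u 6 M) ⟩
    c ^ (7 * M) * u ^ (6 * M) * v ^ M    ≡⟨ *-assoc (c ^ (7 * M)) _ _ ⟩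
    c ^ (7 * M) * (u ^ (6 * M) * v ^ M)  ∎

two-valued : (A → Bool) → ℕ → ℕ → A → ℕ
two-valued g u v x = if g x then u else v

∏-two-valued : ∀ {m} (g : A → Bool) u v (H : Vec A m) →
  ∏ (two-valued g u v) H ≡ u ^ count g H * v ^ count (λ x → not (g x)) H
∏-two-valued g u v [] = refl
∏-two-valued g u v (x ∷ H) with g x
... | true  = trans (cong (u *_) (∏-two-valued g u v H)) (sym (*-assoc u _ _))
... | false = trans (cong (v *_) (∏-two-valued g u v H)) (*-left-comm v (u ^ count g H) _)

exchange : ∀ {u v} a b X Y → u ≤ v → X ≤ a → X + Y ≡ a + b → u ^ a * v ^ b ≤ u ^ X * v ^ Y
exchange {u} {v} a b X Y u≤v X≤a total with m≤n⇒∃[o]m+o≡n X≤a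
... | d , refl = begin
  u ^ (X + d) * v ^ b     ≡⟨ cong (_* v ^ b) (^-distribˡ-+-* u X d) ⟩
  u ^ X * u ^ d * v ^ b   ≤⟨ *-monoˡ-≤ (v ^ b) (*-monoʳ-≤ (u ^ X) (^-monoˡ-≤ d u≤v)) ⟩
  u ^ X * v ^ d * v ^ b   ≡⟨ *-assoc (u ^ X) _ _ ⟩
  u ^ X * (v ^ d * v ^ b) ≡⟨ cong (u ^ X *_) (sym (^-distribˡ-+-* v d b)) ⟩
  u ^ X * v ^ (d + b)     ≡⟨ cong (λ e → u ^ X * v ^ e) (+-cancelˡ-≡ X _ _ (trans (sym (+-assoc X d b)) (sym total))) ⟩
  u ^ X * v ^ Y           ∎
  where open ≤-Reasoning

seven-blocks : ∀ M → 7 * M ≡ 6 * M + M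
seven-blocks = solve-∀

lower-tail : ∀ (xs : List A) (g : A → Bool) M → 7 * length xs ≤ 8 * ∑[ x ← xs ] χ (g x) →
  (8 ^ 7 * 10 ^ 6 * 11) ^ M * ∑[ H ← vectors (7 * M) xs ] χ (count g H ≤ᵇ 6 * M)
    ≤ (81 ^ 7) ^ M * length xs ^ (7 * M)
lower-tail xs g M likely = chernoff xs M (two-valued g 10 11) _ 8 10 11 81 heavy average
  where
  heavy : ∀ H → T (count g H ≤ᵇ 6 * M) → 10 ^ (6 * M) * 11 ^ M ≤ ∏ (two-valued g 10 11) H
  heavy H few = ≤-trans
    (exchange (6 * M) M (count g H) _ (n≤1+n 10) (≤ᵇ⇒≤ _ _ few)
       (trans (count-+-count-not g H) (seven-blocks M)))
    (≤-reflexive (sym (∏-two-valued g 10 11 H)))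
  N : ℕ
  N = length xs
  G : ℕ
  G = ∑[ x ← xs ] χ (g x)
  complement : ∑ xs (two-valued g 10 11) + G ≡ 11 * N
  complement = begin
    ∑ xs (two-valued g 10 11) + G            ≡⟨ sym (∑-+ xs (two-valued g 10 11) (λ x → χ (g x))) ⟩
    ∑[ x ← xs ] (two-valued g 10 11 x + χ (g x)) ≡⟨ ∑-cong xs eleven ⟩
    ∑[ _ ← xs ] 11                           ≡⟨ ∑-const xs 11 ⟩
    N * 11                                   ≡⟨ *-comm N 11 ⟩
    11 * N                                   ∎
    where
    open ≡-Reasoning
    eleven : ∀ x → two-valued g 10 11 x + χ (g x) ≡ 11
    eleven x with g x
    ... | true = refl
    ... | false = refl
  average : 8 * ∑ xs (two-valued g 10 11) ≤ 81 * N
  average = +-cancelʳ-≤ (7 * N) (8 * ∑ xs (two-valued g 10 11)) (81 * N) (begin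
    8 * ∑ xs (two-valued g 10 11) + 7 * N    ≤⟨ +-monoʳ-≤ (8 * ∑ xs (two-valued g 10 11)) likely ⟩
    8 * ∑ xs (two-valued g 10 11) + 8 * G    ≡⟨ sym (*-distribˡ-+ 8 (∑ xs (two-valued g 10 11)) G) ⟩
    8 * (∑ xs (two-valued g 10 11) + G)      ≡⟨ cong (8 *_) complement ⟩
    8 * (11 * N)                             ≡⟨ split N ⟩
    81 * N + 7 * N                           ∎)
    where
    open ≤-Reasoning
    split : ∀ N → 8 * (11 * N) ≡ 81 * N + 7 * N
    split = solve-∀

upper-tail : ∀ (xs : List A) (g : A → Bool) M → 19 * ∑[ x ← xs ] χ (g x) ≤ 16 * length xs →
  (19 ^ 7 * 11 ^ 6 * 10) ^ M * ∑[ H ← vectors (7 * M) xs ] χ (6 * M ≤ᵇ count g H)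
    ≤ (206 ^ 7) ^ M * length xs ^ (7 * M)
upper-tail xs g M unlikely = chernoff xs M (two-valued g 11 10) _ 19 11 10 206 heavy average
  where
  heavy : ∀ H → T (6 * M ≤ᵇ count g H) → 11 ^ (6 * M) * 10 ^ M ≤ ∏ (two-valued g 11 10) H
  heavy H many = begin
    11 ^ (6 * M) * 10 ^ M  ≡⟨ *-comm (11 ^ (6 * M)) _ ⟩
    10 ^ M * 11 ^ (6 * M)  ≤⟨ exchange M (6 * M) Y X (n≤1+n 10) Y≤M (trans (+-comm Y X) X+Y≡M+6M) ⟩
    10 ^ Y * 11 ^ X        ≡⟨ *-comm (10 ^ Y) _ ⟩
    11 ^ X * 10 ^ Y        ≡⟨ sym (∏-two-valued g 11 10 H) ⟩
    ∏ (two-valued g 11 10) H ∎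
    where
    open ≤-Reasoning
    X : ℕ
    X = count g H
    Y : ℕ
    Y = count (λ x → not (g x)) H
    X+Y≡M+6M : X + Y ≡ M + 6 * M
    X+Y≡M+6M = trans (count-+-count-not g H) (trans (seven-blocks M) (+-comm (6 * M) M))
    Y≤M : Y ≤ M
    Y≤M = +-cancelˡ-≤ (6 * M) Y M (begin
      6 * M + Y ≤⟨ +-monoˡ-≤ Y (≤ᵇ⇒≤ _ _ many) ⟩
      X + Y     ≡⟨ trans (count-+-count-not g H) (seven-blocks M) ⟩
      6 * M + M ∎)
  N : ℕ
  N = length xs
  G : ℕ
  G = ∑[ x ← xs ] χ (g x)
  total : ∑ xs (two-valued g 11 10) ≡ 10 * N + G
  total = begin
    ∑ xs (two-valued g 11 10)               ≡⟨ ∑-cong xs ten-plus ⟩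
    ∑[ x ← xs ] (10 + χ (g x))              ≡⟨ ∑-+ xs (λ _ → 10) (λ x → χ (g x)) ⟩
    ∑[ _ ← xs ] 10 + G                      ≡⟨ cong (_+ G) (trans (∑-const xs 10) (*-comm N 10)) ⟩
    10 * N + G                              ∎
    where
    open ≡-Reasoning
    ten-plus : ∀ x → two-valued g 11 10 x ≡ 10 + χ (g x)
    ten-plus x with g x
    ... | true = refl
    ... | false = refl
  average : 19 * ∑ xs (two-valued g 11 10) ≤ 206 * N
  average = begin
    19 * ∑ xs (two-valued g 11 10)  ≡⟨ cong (19 *_) total ⟩
    19 * (10 * N + G)               ≡⟨ *-distribˡ-+ 19 (10 * N) G ⟩
    19 * (10 * N) + 19 * G          ≤⟨ +-monoʳ-≤ (19 * (10 * N)) unlikely ⟩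
    19 * (10 * N) + 16 * N          ≡⟨ merge N ⟩
    206 * N                         ∎
    where
    open ≤-Reasoning
    merge : ∀ N → 19 * (10 * N) + 16 * N ≡ 206 * N
    merge = solve-∀

amplify : ∀ D E S R J .{{_ : NonZero D}} → 2 * E ^ 128 ≤ D ^ 128 →
  D ^ (128 * J) * S ≤ E ^ (128 * J) * R → 2 ^ J * S ≤ R
amplify D E S R J ratio bound = *-cancelˡ-≤ (D ^ (128 * J)) {{m^n≢0 D (128 * J)}} (begin
  D ^ (128 * J) * (2 ^ J * S)     ≡⟨ *-left-comm (D ^ (128 * J)) (2 ^ J) S ⟩
  2 ^ J * (D ^ (128 * J) * S)     ≤⟨ *-monoʳ-≤ (2 ^ J) bound ⟩
  2 ^ J * (E ^ (128 * J) * R)     ≡⟨ sym (*-assoc (2 ^ J) _ R) ⟩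
  2 ^ J * E ^ (128 * J) * R       ≤⟨ *-monoˡ-≤ R per-J ⟩
  D ^ (128 * J) * R               ∎)
  where
  open ≤-Reasoning
  per-J : 2 ^ J * E ^ (128 * J) ≤ D ^ (128 * J)
  per-J = begin
    2 ^ J * E ^ (128 * J)   ≡⟨ cong (2 ^ J *_) (sym (^-*-assoc E 128 J)) ⟩
    2 ^ J * (E ^ 128) ^ J   ≡⟨ sym (*-^-distrib 2 (E ^ 128) J) ⟩
    (2 * E ^ 128) ^ J       ≤⟨ ^-monoˡ-≤ J ratio ⟩
    (D ^ 128) ^ J           ≡⟨ ^-*-assoc D 128 J ⟩
    D ^ (128 * J)           ∎

lower-ratio : 2 * (81 ^ 7) ^ 128 ≤ (8 ^ 7 * 10 ^ 6 * 11) ^ 128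
lower-ratio = ≤ᵇ⇒≤ _ _ tt

upper-ratio : 2 * (206 ^ 7) ^ 128 ≤ (19 ^ 7 * 11 ^ 6 * 10) ^ 128
upper-ratio = ≤ᵇ⇒≤ _ _ tt

-- Bernoulli-type estimates for (p/q)^b with q = p + 1.
-- Union bound: q^b - p^b ≤ b·q^(b-1), i.e. q^(b+1) ≤ q·p^b + b·q^b.
pow-gap : ∀ p b → suc p ^ suc b ≤ suc p * p ^ b + b * suc p ^ b
pow-gap p zero = ≤-reflexive (sym (+-identityʳ _))
pow-gap p (suc b) = begin
  q * q ^ suc b                                  ≤⟨ *-monoʳ-≤ q (pow-gap p b) ⟩
  q * (q * p ^ b + b * q ^ b)                    ≡⟨ expand p (p ^ b) b (q ^ b) ⟩
  q * (p * p ^ b) + q * p ^ b + b * (q * q ^ b)  ≤⟨ +-monoˡ-≤ (b * (q * q ^ b)) (+-monoʳ-≤ (q * (p * p ^ b))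
                                                      (*-monoʳ-≤ q (^-monoˡ-≤ b (n≤1+n p)))) ⟩
  q * (p * p ^ b) + q * q ^ b + b * (q * q ^ b)  ≡⟨ +-assoc (q * (p * p ^ b)) _ _ ⟩
  q * (p * p ^ b) + suc b * (q * q ^ b)          ∎
  where
  open ≤-Reasoning
  q : ℕ
  q = suc p
  expand : ∀ p x b y → (1 + p) * ((1 + p) * x + b * y) ≡ (1 + p) * (p * x) + (1 + p) * x + b * ((1 + p) * y)
  expand = solve-∀

-- (1 - 1/q)^j ≤ q/(q + j), i.e. p^j (q + j) ≤ q^(j+1).
pow-decay : ∀ p j → p ^ j * (suc p + j) ≤ suc p ^ suc j
pow-decay p zero = ≤-reflexive (trans (+-identityʳ _) (trans (cong suc (+-identityʳ p)) (sym (*-identityʳ (suc p)))))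
pow-decay p (suc j) = begin
  p * p ^ j * (q + suc j)             ≡⟨ rotate p (p ^ j) (q + suc j) ⟩
  p ^ j * (p * (q + suc j))           ≤⟨ *-monoʳ-≤ (p ^ j) (m≤m+n (p * (q + suc j)) (suc j)) ⟩
  p ^ j * (p * (q + suc j) + suc j)   ≡⟨ cong (p ^ j *_) (sym (regroup p j)) ⟩
  p ^ j * (q * (q + j))               ≡⟨ *-left-comm (p ^ j) q (q + j) ⟩
  q * (p ^ j * (q + j))               ≤⟨ *-monoʳ-≤ q (pow-decay p j) ⟩
  q * q ^ suc j                       ∎
  where
  open ≤-Reasoning
  q : ℕ
  q = suc p
  rotate : ∀ a x y → a * x * y ≡ x * (a * y)
  rotate = solve-∀
  regroup : ∀ p j → (1 + p) * ((1 + p) + j) ≡ p * ((1 + p) + (1 + j)) + (1 + j)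
  regroup = solve-∀

-- With p = 8k'+4 (so q = p+1 = 8k - 3 for k = k'+1):  (p/q)^b ≥ 7/8 for b ≤ k' ...
few-points : ∀ k' b → b ≤ k' → 7 * suc (8 * k' + 4) ^ b ≤ 8 * (8 * k' + 4) ^ b
few-points k' b b≤k' = *-cancelˡ-≤ q (+-cancelʳ-≤ (8 * b * q ^ b) _ _ (begin
  q * (7 * q ^ b) + 8 * b * q ^ b  ≡⟨ rearrange₁ q (q ^ b) b ⟩
  7 * q * q ^ b + 8 * b * q ^ b    ≤⟨ +-monoʳ-≤ (7 * q * q ^ b) (*-monoˡ-≤ (q ^ b) 8b≤q) ⟩
  7 * q * q ^ b + q * q ^ b        ≡⟨ rearrange₂ q (q ^ b) ⟩
  8 * (q * q ^ b)                  ≤⟨ *-monoʳ-≤ 8 (pow-gap p b) ⟩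
  8 * (q * p ^ b + b * q ^ b)      ≡⟨ rearrange₃ q (p ^ b) b (q ^ b) ⟩
  q * (8 * p ^ b) + 8 * b * q ^ b  ∎))
  where
  open ≤-Reasoning
  p : ℕ
  p = 8 * k' + 4
  q : ℕ
  q = suc p
  8b≤q : 8 * b ≤ q
  8b≤q = ≤-trans (*-monoʳ-≤ 8 b≤k') (≤-trans (m≤m+n (8 * k') 4) (n≤1+n _))
  rearrange₁ : ∀ q x b → q * (7 * x) + 8 * b * x ≡ 7 * q * x + 8 * b * x
  rearrange₁ = solve-∀
  rearrange₂ : ∀ q x → 7 * q * x + q * x ≡ 8 * (q * x)
  rearrange₂ = solve-∀
  rearrange₃ : ∀ q x b y → 8 * (q * x + b * y) ≡ q * (8 * x) + 8 * b * y
  rearrange₃ = solve-∀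

-- ... and (p/q)^(2k'+1) ≤ 16/19.
many-points : ∀ k' → 19 * (8 * k' + 4) ^ (2 * k' + 1) ≤ 16 * suc (8 * k' + 4) ^ (2 * k' + 1)
many-points k' = *-cancelˡ-≤ q (begin
  q * (19 * p ^ j)     ≡⟨ rearrange₁ q (p ^ j) ⟩
  p ^ j * (19 * q)     ≤⟨ *-monoʳ-≤ (p ^ j) linear ⟩
  p ^ j * (16 * (q + j)) ≡⟨ *-left-comm (p ^ j) 16 (q + j) ⟩
  16 * (p ^ j * (q + j)) ≤⟨ *-monoʳ-≤ 16 (pow-decay p j) ⟩
  16 * (q * q ^ j)     ≡⟨ *-left-comm 16 q (q ^ j) ⟩
  q * (16 * q ^ j)     ∎)
  where
  open ≤-Reasoning
  p : ℕ
  p = 8 * k' + 4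
  q : ℕ
  q = suc p
  j : ℕ
  j = 2 * k' + 1
  linear : 19 * q ≤ 16 * (q + j)
  linear = begin
    19 * q                ≡⟨ lhs k' ⟩
    152 * k' + 95         ≤⟨ +-monoˡ-≤ 95 (*-monoˡ-≤ k' (m≤m+n 152 8)) ⟩
    160 * k' + 95         ≤⟨ n≤1+n _ ⟩
    1 + (160 * k' + 95)   ≡⟨ rhs k' ⟩
    16 * (q + j)          ∎
    where
    lhs : ∀ k → 19 * (1 + (8 * k + 4)) ≡ 152 * k + 95
    lhs = solve-∀
    rhs : ∀ k → 1 + (160 * k + 95) ≡ 16 * ((1 + (8 * k + 4)) + (2 * k + 1))
    rhs = solve-∀
  rearrange₁ : ∀ q x → q * (19 * x) ≡ x * (19 * q)
  rearrange₁ = solve-∀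

length-colourings : ∀ p n → length (colourings p n) ≡ suc p ^ n
length-colourings p n = trans (length-vectors n (allFin (suc p))) (cong (_^ n) (length-allFin (suc p)))

isolation-likely : ∀ k' n (a : Fin n) B → lookup B a ≡ false → ∣ B ∣ ≤ k' →
  7 * length (colourings (8 * k' + 4) n) ≤ 8 * ∑[ h ← colourings (8 * k' + 4) n ] χ (isolates a B h)
isolation-likely k' n a B a∉B small = *-cancelˡ-≤ (q ^ b) {{m^n≢0 q b}} (begin
  q ^ b * (7 * length (colourings p n)) ≡⟨ cong (λ z → q ^ b * (7 * z)) (length-colourings p n) ⟩
  q ^ b * (7 * q ^ n)                   ≡⟨ rearrange₁ (q ^ b) 7 (q ^ n) ⟩
  7 * q ^ b * q ^ n                     ≤⟨ *-monoˡ-≤ (q ^ n) (few-points k' b small) ⟩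
  8 * p ^ b * q ^ n                     ≡⟨ *-assoc 8 (p ^ b) (q ^ n) ⟩
  8 * (p ^ b * q ^ n)                   ≡⟨ cong (8 *_) (sym (∏-allowed p B)) ⟩
  8 * (∏ (allowed p) B * q ^ b)         ≡⟨ cong (λ z → 8 * (z * q ^ b)) (sym (isolate-count p n a B a∉B)) ⟩
  8 * (I * q ^ b)                       ≡⟨ rearrange₂ 8 I (q ^ b) ⟩
  q ^ b * (8 * I)                       ∎)
  where
  open ≤-Reasoning
  p : ℕ
  p = 8 * k' + 4
  q : ℕ
  q = suc p
  b : ℕ
  b = ∣ B ∣
  I : ℕ
  I = ∑[ h ← colourings p n ] χ (isolates a B h)
  rearrange₁ : ∀ x c y → x * (c * y) ≡ c * x * y
  rearrange₁ = solve-∀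
  rearrange₂ : ∀ c g x → c * (g * x) ≡ x * (c * g)
  rearrange₂ = solve-∀

isolation-unlikely : ∀ k' n (a : Fin n) B → lookup B a ≡ false → ∣ B ∣ ≡ 2 * k' + 1 →
  19 * ∑[ h ← colourings (8 * k' + 4) n ] χ (isolates a B h) ≤ 16 * length (colourings (8 * k' + 4) n)
isolation-unlikely k' n a B a∉B large = *-cancelˡ-≤ (q ^ b) {{m^n≢0 q b}} (begin
  q ^ b * (19 * I)                      ≡⟨ rearrange₂ 19 I (q ^ b) ⟩
  19 * (I * q ^ b)                      ≡⟨ cong (λ z → 19 * (z * q ^ b)) (isolate-count p n a B a∉B) ⟩
  19 * (∏ (allowed p) B * q ^ b)        ≡⟨ cong (19 *_) (∏-allowed p B) ⟩
  19 * (p ^ b * q ^ n)                  ≡⟨ sym (*-assoc 19 (p ^ b) (q ^ n)) ⟩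
  19 * p ^ b * q ^ n                    ≡⟨ cong (λ e → 19 * p ^ e * q ^ n) large ⟩
  19 * p ^ (2 * k' + 1) * q ^ n         ≤⟨ *-monoˡ-≤ (q ^ n) (many-points k') ⟩
  16 * q ^ (2 * k' + 1) * q ^ n         ≡⟨ cong (λ e → 16 * q ^ e * q ^ n) (sym large) ⟩
  16 * q ^ b * q ^ n                    ≡⟨ sym (rearrange₁ (q ^ b) 16 (q ^ n)) ⟩
  q ^ b * (16 * q ^ n)                  ≡⟨ cong (λ z → q ^ b * (16 * z)) (sym (length-colourings p n)) ⟩
  q ^ b * (16 * length (colourings p n)) ∎)
  where
  open ≤-Reasoning
  p : ℕ
  p = 8 * k' + 4
  q : ℕ
  q = suc p
  b : ℕ
  b = ∣ B ∣
  I : ℕ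
  I = ∑[ h ← colourings p n ] χ (isolates a B h)
  rearrange₁ : ∀ x c y → x * (c * y) ≡ c * x * y
  rearrange₁ = solve-∀
  rearrange₂ : ∀ c g x → x * (c * g) ≡ c * (g * x)
  rearrange₂ = solve-∀

colourClass : ∀ {q n} → Vec (Fin q) n → Fin q → Subset n
colourClass h y = Vec.map (_== y) h

classes : ∀ {q n m} → Vec (Vec (Fin q) n) m → Vec (Subset n) (m * q)
classes H = concat (Vec.map (λ h → tabulate (colourClass h)) H)

erase : ∀ {n} → Subset n → Fin n → Subset n
erase (b ∷ A) zero = false ∷ A
erase (b ∷ A) (suc a) = b ∷ erase A a

erase-∉ : ∀ {n} (A : Subset n) a → lookup (erase A a) a ≡ false
erase-∉ (b ∷ A) zero = refl
erase-∉ (b ∷ A) (suc a) = erase-∉ A a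

erase-size : ∀ {n} (A : Subset n) a → lookup A a ≡ true → suc ∣ erase A a ∣ ≡ ∣ A ∣
erase-size (true ∷ A) zero _ = refl
erase-size (true ∷ A) (suc a) a∈A = cong suc (erase-size A a a∈A)
erase-size (false ∷ A) (suc a) a∈A = erase-size A a a∈A

class-misses : ∀ {q n} (y : Fin q) (h : Vec (Fin q) n) B → does ((colourClass h y ∩ B) ≟ˢ ∅) ≡ avoids y B h
class-misses y [] [] = refl
class-misses y (x ∷ h) (b ∷ B) = cong₂ _∧_ (first (x == y) b) (class-misses y h B)
  where
  first : ∀ c b → does ((c ∧ b) ≟ᵇ false) ≡ (not b ∨ not c)
  first true true = refl
  first true false = refl
  first false true = refl
  first false false = refl

class-meets-in : ∀ {q n} (y : Fin q) (h : Vec (Fin q) n) (A : Subset n) a → lookup A a ≡ true →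
  does ((colourClass h y ∩ A) ≟ˢ ⁅ a ⁆) ≡ (y == lookup h a) ∧ avoids y (erase A a) h
class-meets-in y (x ∷ h) (true ∷ A) zero _ rewrite class-misses y h A | ==-sym y x with x == y
... | true = refl
... | false = refl
class-meets-in y (x ∷ h) (b ∷ A) (suc a) a∈A rewrite class-meets-in y h A a a∈A =
  shuffle (x == y) b (y == lookup h a) (avoids y (erase A a) h)
  where
  shuffle : ∀ c b Y R → does ((c ∧ b) ≟ᵇ false) ∧ (Y ∧ R) ≡ Y ∧ ((not b ∨ not c) ∧ R)
  shuffle c b false R = ∧-zeroʳ _
  shuffle true true true R = refl
  shuffle true false true R = refl
  shuffle false true true R = refl
  shuffle false false true R = refl

hits-count : ∀ {q n m} (H : Vec (Vec (Fin q) n) m) (A : Subset n) a → lookup A a ≡ true →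
  ∣ Hits a A (lookup (classes H)) ∣ ≡ count (isolates a (erase A a)) H
hits-count {q} H A a a∈A = begin
  ∣ Hits a A (lookup (classes H)) ∣  ≡⟨ cong ∣_∣ (trans (tabulate-∘ meets (lookup (classes H)))
                                                        (cong (Vec.map meets) (tabulate∘lookup (classes H)))) ⟩
  ∣ Vec.map meets (classes H) ∣      ≡⟨ card-map meets (classes H) ⟩
  count meets (classes H)            ≡⟨ per-colouring H ⟩
  count (isolates a (erase A a)) H   ∎
  where
  open ≡-Reasoning
  meets : Subset _ → Bool
  meets S = does ((S ∩ A) ≟ˢ ⁅ a ⁆)
  one-colouring : ∀ h → count meets (tabulate (colourClass h)) ≡ χ (isolates a (erase A a) h)
  one-colouring h = trans (count-tabulate meets (colourClass h))
    (trans (∑-cong (allFin q) (λ y → cong χ (class-meets-in y h A a a∈A)))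
           (∑-select q (lookup h a) (λ y → avoids y (erase A a) h)))
  per-colouring : ∀ {m} (H : Vec _ m) → count meets (classes H) ≡ count (isolates a (erase A a)) H
  per-colouring [] = refl
  per-colouring (h ∷ H) = trans (count-++ meets (tabulate (colourClass h)) (classes H))
                                (cong₂ _+_ (one-colouring h) (per-colouring H))

avoids-antitone : ∀ {q n} (y : Fin q) (B B' : Subset n) (h : Vec (Fin q) n) → B ⊆ B' →
  T (avoids y B' h) → T (avoids y B h)
avoids-antitone y [] [] [] _ _ = tt
avoids-antitone y (false ∷ B) (b' ∷ B') (x ∷ h) B⊆B' av with not b' ∨ not (x == y)
... | true = avoids-antitone y B B' h (drop-∷-⊆ B⊆B') av
avoids-antitone y (true ∷ B) (b' ∷ B') (x ∷ h) B⊆B' av with B⊆B' Vec.here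
... | Vec.here with x == y
...   | false = avoids-antitone y B B' h (drop-∷-⊆ B⊆B') av

∉-antitone : ∀ {n} (B B' : Subset n) a → B ⊆ B' → lookup B' a ≡ false → lookup B a ≡ false
∉-antitone B B' a B⊆B' a∉B' with lookup B a in eq
... | false = refl
... | true = trans (sym ([]=⇒lookup (B⊆B' (lookup⇒[]= a B eq)))) a∉B'

subset-of-size : ∀ {n} (B' : Subset n) s → s ≤ ∣ B' ∣ → Σ (Subset n) (λ B → B ⊆ B' × ∣ B ∣ ≡ s)
subset-of-size [] zero _ = [] , (λ ()) , refl
subset-of-size (false ∷ B') s s≤ with subset-of-size B' s s≤
... | B , B⊆B' , size = false ∷ B , out⊆ B⊆B' , size
subset-of-size {suc n} (true ∷ B') zero _ = ∅ , ⊥⊆ , ∣⊥∣≡0 (suc n)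
subset-of-size (true ∷ B') (suc s) (s≤s s≤) with subset-of-size B' s s≤
... | B , B⊆B' , size = true ∷ B , s⊆s B⊆B' , cong suc size

union-bound : ∀ {E : Set} (samples : List A) (events : List E) (bad : E → A → Bool) (w : E → ℕ) D →
  0 < length samples →
  (∀ e → D * ∑[ s ← samples ] χ (bad e s) ≤ w e * length samples) → ∑ events w < D →
  ∃ λ s → ∀ {e} → e ∈ˡ events → ¬ T (bad e s)
union-bound samples events bad w D nonempty rare total<D
  with zero-or-≥length samples (λ s → ∑[ e ← events ] χ (bad e s))
... | inj₁ (s , none) = s , λ e∈ → χ≡0 (∑≡0⇒ events (λ e → χ (bad e s)) none e∈)
  where
  χ≡0 : ∀ {b} → χ b ≡ 0 → ¬ T b
  χ≡0 {false} _ ()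
... | inj₂ crowded = ⊥-elim (<-irrefl refl (begin-strict
  D * L                                           ≤⟨ *-monoʳ-≤ D crowded ⟩
  D * ∑[ s ← samples ] ∑[ e ← events ] χ (bad e s) ≡⟨ cong (D *_) (∑-swap samples events (λ s e → χ (bad e s))) ⟩
  D * ∑[ e ← events ] ∑[ s ← samples ] χ (bad e s) ≡⟨ sym (∑-*ˡ events D (λ e → ∑[ s ← samples ] χ (bad e s))) ⟩
  ∑[ e ← events ] (D * ∑[ s ← samples ] χ (bad e s)) ≤⟨ ∑-mono events rare ⟩
  ∑[ e ← events ] (w e * L)                        ≡⟨ ∑-*ʳ events L w ⟩
  ∑ events w * L                                   <⟨ *-monoˡ-< L {{>-nonZero nonempty}} total<D ⟩
  D * L                                            ∎))
  where
  open ≤-Reasoning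
  L : ℕ
  L = length samples

few-small-subsets : ∀ n s → ∑[ B ← vectors n bools ] χ (∣ B ∣ ≤ᵇ s) ≤ suc n ^ s
few-small-subsets zero s = ≤-reflexive (sym (^-zeroˡ s))
few-small-subsets (suc n) zero = begin
  ∑[ B ← vectors (suc n) bools ] χ (∣ B ∣ ≤ᵇ 0)              ≡⟨ ∑-vectors-suc n bools _ ⟩
  ∑[ B ← vectors n bools ] χ (∣ B ∣ ≤ᵇ 0) + (∑[ B ← vectors n bools ] 0 + 0)
                                                            ≡⟨ cong (λ z → ∑[ B ← vectors n bools ] χ (∣ B ∣ ≤ᵇ 0) + (z + 0)) (∑-zero (vectors n bools)) ⟩
  ∑[ B ← vectors n bools ] χ (∣ B ∣ ≤ᵇ 0) + 0                ≡⟨ +-identityʳ _ ⟩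
  ∑[ B ← vectors n bools ] χ (∣ B ∣ ≤ᵇ 0)                    ≤⟨ few-small-subsets n 0 ⟩
  1                                                         ∎
  where
  open ≤-Reasoning
few-small-subsets (suc n) (suc s) = begin
  ∑[ B ← vectors (suc n) bools ] χ (∣ B ∣ ≤ᵇ suc s)         ≡⟨ ∑-vectors-suc n bools _ ⟩
  ∑[ B ← vectors n bools ] χ (∣ B ∣ ≤ᵇ suc s) + (∑[ B ← vectors n bools ] χ (suc ∣ B ∣ ≤ᵇ suc s) + 0)
                                                          ≡⟨ cong (λ z → ∑[ B ← vectors n bools ] χ (∣ B ∣ ≤ᵇ suc s) + (z + 0)) (∑-cong (vectors n bools)
                                                               (λ B → cong χ (suc≤ᵇsuc ∣ B ∣ s))) ⟩
  ∑[ B ← vectors n bools ] χ (∣ B ∣ ≤ᵇ suc s) + (∑[ B ← vectors n bools ] χ (∣ B ∣ ≤ᵇ s) + 0)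
                                                          ≤⟨ +-mono-≤ (few-small-subsets n (suc s))
                                                                      (+-monoˡ-≤ 0 (few-small-subsets n s)) ⟩
  suc n * suc n ^ s + (suc n ^ s + 0)                     ≡⟨ collect (suc n) (suc n ^ s) ⟩
  suc (suc n) * suc n ^ s                                 ≤⟨ *-monoʳ-≤ (suc (suc n)) (^-monoˡ-≤ s (n≤1+n (suc n))) ⟩
  suc (suc n) * suc (suc n) ^ s                           ∎
  where
  open ≤-Reasoning
  collect : ∀ a x → a * x + (x + 0) ≡ (1 + a) * x
  collect = solve-∀
  suc≤ᵇsuc : ∀ x s → (suc x ≤ᵇ suc s) ≡ (x ≤ᵇ s)
  suc≤ᵇsuc zero s = refl
  suc≤ᵇsuc (suc x) s = refl

above-threshold : ∀ {x y} → x < y → suc (2 * x) < 2 * y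
above-threshold {x} {y} x<y = ≤-trans (≤-reflexive (double-suc x)) (*-monoʳ-≤ 2 x<y)
  where
  double-suc : ∀ x → suc (suc (2 * x)) ≡ 2 * suc x
  double-suc = solve-∀

below-threshold : ∀ {x y} → y ≤ x → 2 * y < suc (2 * x)
below-threshold y≤x = s≤s (*-monoʳ-≤ 2 y≤x)

guarded : ∀ b {S R} K → (T b → K * S ≤ R) → K * (χ b * S) ≤ χ b * R
guarded true {S} {R} K bound = subst₂ _≤_ (cong (K *_) (sym (*-identityˡ S))) (sym (*-identityˡ R)) (bound tt)
guarded false K _ = ≤-reflexive (*-zeroʳ K)

module Construction (n k' J : ℕ) where

  p M : ℕ
  p = 8 * k' + 4
  M = 128 * J

  Family : Set
  Family = Vec (Vec (Fin (suc p)) n) (7 * M)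

  Good : Family → Set
  Good H = (∀ a B → lookup B a ≡ false → ∣ B ∣ ≤ k' → 6 * M < count (isolates a B) H) ×
           (∀ a B → lookup B a ≡ false → ∣ B ∣ ≡ 2 * k' + 1 → count (isolates a B) H < 6 * M)

  small? large? : Fin n → Subset n → Bool
  small? a B = not (lookup B a) ∧ (∣ B ∣ ≤ᵇ k')
  large? a B = not (lookup B a) ∧ (∣ B ∣ ≡ᵇ 2 * k' + 1)

  too-few too-many : Fin n → Subset n → Family → Bool
  too-few a B H = count (isolates a B) H ≤ᵇ 6 * M
  too-many a B H = 6 * M ≤ᵇ count (isolates a B) H

  fails : Fin n × Subset n → Family → Bool
  fails (a , B) H = (small? a B ∧ too-few a B H) ∨ (large? a B ∧ too-many a B H)

  relevant : Fin n × Subset n → ℕ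
  relevant (a , B) = χ (small? a B) + χ (large? a B)

  tests : List (Fin n × Subset n)
  tests = cartesianProduct (allFin n) (vectors n bools)

  samples : List Family
  samples = vectors (7 * M) (colourings p n)

  length-samples : length samples ≡ (suc p ^ n) ^ (7 * M)
  length-samples = trans (length-vectors (7 * M) (colourings p n)) (cong (_^ (7 * M)) (length-colourings p n))

  nonempty : 0 < length samples
  nonempty = subst (0 <_) (sym length-samples) (m^n>0 (suc p ^ n) {{m^n≢0 (suc p) n}} (7 * M))

  small-rare : ∀ a B → T (small? a B) → 2 ^ J * ∑[ H ← samples ] χ (too-few a B H) ≤ length samples
  small-rare a B small with T-not∧ small
  ... | a∉B , size = ≤-trans
    (amplify (8 ^ 7 * 10 ^ 6 * 11) (81 ^ 7) _ (length (colourings p n) ^ (7 * M)) J lower-ratio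
      (lower-tail (colourings p n) (isolates a B) M (isolation-likely k' n a B a∉B (≤ᵇ⇒≤ _ _ size))))
    (≤-reflexive (sym (length-vectors (7 * M) (colourings p n))))

  large-rare : ∀ a B → T (large? a B) → 2 ^ J * ∑[ H ← samples ] χ (too-many a B H) ≤ length samples
  large-rare a B large with T-not∧ large
  ... | a∉B , size = ≤-trans
    (amplify (19 ^ 7 * 11 ^ 6 * 10) (206 ^ 7) _ (length (colourings p n) ^ (7 * M)) J upper-ratio
      (upper-tail (colourings p n) (isolates a B) M (isolation-unlikely k' n a B a∉B (≡ᵇ⇒≡ _ _ size))))
    (≤-reflexive (sym (length-vectors (7 * M) (colourings p n))))

  rare : ∀ t → 2 ^ J * ∑[ H ← samples ] χ (fails t H) ≤ relevant t * length samples
  rare (a , B) = begin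
    2 ^ J * ∑[ H ← samples ] χ (fails (a , B) H)
      ≤⟨ *-monoʳ-≤ (2 ^ J) (∑-mono samples split) ⟩
    2 ^ J * ∑[ H ← samples ] (χ s * χ (few H) + χ l * χ (many H))
      ≡⟨ cong (2 ^ J *_) (trans (∑-+ samples _ _) (cong₂ _+_ (∑-*ˡ samples (χ s) _) (∑-*ˡ samples (χ l) _))) ⟩
    2 ^ J * (χ s * ∑[ H ← samples ] χ (few H) + χ l * ∑[ H ← samples ] χ (many H))
      ≡⟨ *-distribˡ-+ (2 ^ J) _ _ ⟩
    2 ^ J * (χ s * ∑[ H ← samples ] χ (few H)) + 2 ^ J * (χ l * ∑[ H ← samples ] χ (many H))
      ≤⟨ +-mono-≤ (guarded s (2 ^ J) (small-rare a B)) (guarded l (2 ^ J) (large-rare a B)) ⟩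
    χ s * length samples + χ l * length samples
      ≡⟨ sym (*-distribʳ-+ (length samples) (χ s) (χ l)) ⟩
    relevant (a , B) * length samples ∎
    where
    open ≤-Reasoning
    s : Bool
    s = small? a B
    l : Bool
    l = large? a B
    few many : Family → Bool
    few = too-few a B
    many = too-many a B
    split : ∀ H → χ (fails (a , B) H) ≤ χ s * χ (few H) + χ l * χ (many H)
    split H = ≤-trans (χ-∨ (s ∧ few H) (l ∧ many H)) (≤-reflexive (cong₂ _+_ (χ-∧ s (few H)) (χ-∧ l (many H))))

  relevant-total : ∑ tests relevant ≤ n * (suc n ^ k' + suc n ^ (2 * k' + 1))
  relevant-total = begin
    ∑ tests relevant
      ≡⟨ ∑-cartesianProduct (allFin n) (vectors n bools) relevant ⟩
    ∑[ a ← allFin n ] ∑[ B ← vectors n bools ] relevant (a , B)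
      ≤⟨ ∑-mono (allFin n) (λ a → ∑-mono (vectors n bools) (λ B → +-mono-≤ (small≤ a B) (large≤ a B))) ⟩
    ∑[ a ← allFin n ] ∑[ B ← vectors n bools ] (χ (∣ B ∣ ≤ᵇ k') + χ (∣ B ∣ ≤ᵇ 2 * k' + 1))
      ≤⟨ ∑-mono (allFin n) (λ a → ≤-trans (≤-reflexive (∑-+ (vectors n bools) _ _))
           (+-mono-≤ (few-small-subsets n k') (few-small-subsets n (2 * k' + 1)))) ⟩
    ∑[ a ← allFin n ] (suc n ^ k' + suc n ^ (2 * k' + 1))
      ≡⟨ trans (∑-const (allFin n) per-point) (cong (_* per-point) (length-allFin n)) ⟩
    n * per-point ∎
    where
    open ≤-Reasoning
    per-point : ℕ
    per-point = suc n ^ k' + suc n ^ (2 * k' + 1)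
    small≤ : ∀ a B → χ (small? a B) ≤ χ (∣ B ∣ ≤ᵇ k')
    small≤ a B = χ-mono {small? a B} (λ t → proj₂ (to (T-∧ {not (lookup B a)}) t))
    large≤ : ∀ a B → χ (large? a B) ≤ χ (∣ B ∣ ≤ᵇ 2 * k' + 1)
    large≤ a B = χ-mono {large? a B}
      (λ t → ≤⇒≤ᵇ (≤-reflexive (≡ᵇ⇒≡ ∣ B ∣ (2 * k' + 1) (proj₂ (to (T-∧ {not (lookup B a)}) t)))))

  passing⇒good : ∀ H → (∀ {t} → t ∈ˡ tests → ¬ T (fails t H)) → Good H
  passing⇒good H passes = isolated-often , isolated-rarely
    where
    is-test : ∀ a B → (a , B) ∈ˡ tests
    is-test a B = ∈-cartesianProduct⁺ (∈-allFin a) (∈-vectors n bools ∈-bools B)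
    isolated-often : ∀ a B → lookup B a ≡ false → ∣ B ∣ ≤ k' → 6 * M < count (isolates a B) H
    isolated-often a B a∉B size = ≰⇒> λ le → passes (is-test a B)
      (from T-∨ (inj₁ (from T-∧ (subst (λ b → T (not b ∧ (∣ B ∣ ≤ᵇ k'))) (sym a∉B) (≤⇒≤ᵇ size) , ≤⇒≤ᵇ le))))
    isolated-rarely : ∀ a B → lookup B a ≡ false → ∣ B ∣ ≡ 2 * k' + 1 → count (isolates a B) H < 6 * M
    isolated-rarely a B a∉B size = ≰⇒> λ le → passes (is-test a B)
      (from T-∨ (inj₂ (from T-∧ (subst (λ b → T (not b ∧ (∣ B ∣ ≡ᵇ 2 * k' + 1))) (sym a∉B)
                                       (≡⇒≡ᵇ _ _ size) , ≤⇒≤ᵇ le))))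

  good-exists : n * (suc n ^ k' + suc n ^ (2 * k' + 1)) < 2 ^ J → Σ Family Good
  good-exists few-tests with union-bound samples tests fails relevant (2 ^ J) nonempty rare
                                         (≤-<-trans relevant-total few-tests)
  ... | H , passes = H , passing⇒good H passes

  -- The colour classes of a good family form a k-distinguisher with threshold
  -- ξ = 6M + 1/2, i.e. t = 2ξ = 12M + 1.
  good⇒distinguisher : ∀ H → Good H → IsDistinguisherWith (suc k') (suc (2 * (6 * M))) (lookup (classes H))
  good⇒distinguisher H (isolated-often , isolated-rarely) A a a∈A = small-set , large-set
    where
    a∈A′ : lookup A a ≡ true
    a∈A′ = []=⇒lookup a∈A
    hits : ∣ Hits a A (lookup (classes H)) ∣ ≡ count (isolates a (erase A a)) H
    hits = hits-count H A a a∈A′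
    small-set : ∣ A ∣ ≤ suc k' → suc (2 * (6 * M)) < 2 * ∣ Hits a A (lookup (classes H)) ∣
    small-set size rewrite hits = above-threshold (isolated-often a (erase A a) (erase-∉ A a)
      (s≤s⁻¹ (subst (_≤ suc k') (sym (erase-size A a a∈A′)) size)))
    large-set : 2 * suc k' ≤ ∣ A ∣ → 2 * ∣ Hits a A (lookup (classes H)) ∣ < suc (2 * (6 * M))
    large-set size rewrite hits = below-threshold (<⇒≤ (≤-<-trans fewer (isolated-rarely a C a∉C ∣C∣≡)))
      where
      enough : 2 * k' + 1 ≤ ∣ erase A a ∣
      enough = s≤s⁻¹ (subst₂ _≤_ (double-suc k') (sym (erase-size A a a∈A′)) size)
        where
        double-suc : ∀ k → 2 * suc k ≡ suc (2 * k + 1)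
        double-suc = solve-∀
      chosen : Σ (Subset n) (λ C → C ⊆ erase A a × ∣ C ∣ ≡ 2 * k' + 1)
      chosen = subset-of-size (erase A a) (2 * k' + 1) enough
      C : Subset n
      C = proj₁ chosen
      C⊆ : C ⊆ erase A a
      C⊆ = proj₁ (proj₂ chosen)
      ∣C∣≡ : ∣ C ∣ ≡ 2 * k' + 1
      ∣C∣≡ = proj₂ (proj₂ chosen)
      a∉C : lookup C a ≡ false
      a∉C = ∉-antitone C (erase A a) a C⊆ (erase-∉ A a)
      fewer : count (isolates a (erase A a)) H ≤ count (isolates a C) H
      fewer = count-mono (isolates a C) (isolates a (erase A a))
                (λ h → avoids-antitone (lookup h a) C (erase A a) h C⊆) H

-- n ≤ 2^⌈log₂ n⌉, by the recursion ⌈log₂ (n+2)⌉ = 1 + ⌈log₂ (⌈n/2⌉ + 1)⌉ defining ⌈log₂_⌉.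
n≤2^⌈log₂n⌉ : ∀ n → n ≤ 2 ^ ⌈log₂ n ⌉
n≤2^⌈log₂n⌉ n = go n (<-wellFounded n)
  where
  go : ∀ n (acc-n : Acc _<_ n) → n ≤ 2 ^ ⌈log2⌉ n acc-n
  go zero _ = z≤n
  go (suc zero) _ = s≤s z≤n
  go (suc (suc n)) (acc rs) = begin
    suc (suc n)                  ≤⟨ s≤s (s≤s halves) ⟩
    suc (suc (⌈ n /2⌉ + ⌈ n /2⌉)) ≡⟨ double-suc ⌈ n /2⌉ ⟩
    2 * suc ⌈ n /2⌉              ≤⟨ *-monoʳ-≤ 2 (go (suc ⌈ n /2⌉) (rs (⌈n/2⌉<n n))) ⟩
    2 * 2 ^ ⌈log2⌉ (suc ⌈ n /2⌉) (rs (⌈n/2⌉<n n)) ∎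
    where
    open ≤-Reasoning
    halves : n ≤ ⌈ n /2⌉ + ⌈ n /2⌉
    halves = ≤-trans (≤-reflexive (sym (⌊n/2⌋+⌈n/2⌉≡n n))) (+-monoˡ-≤ ⌈ n /2⌉ (⌊n/2⌋≤⌈n/2⌉ n))
    double-suc : ∀ x → suc (suc (x + x)) ≡ 2 * suc x
    double-suc = solve-∀

tests-fit : ∀ n ℓ k' → n ≤ 2 ^ ℓ → 1 ≤ ℓ →
  n * (suc n ^ k' + suc n ^ (2 * k' + 1)) < 2 ^ (4 * suc k' * ℓ + 2)
tests-fit n ℓ k' n≤2^ℓ 1≤ℓ = begin-strict
  n * (suc n ^ k' + Y)                      ≤⟨ *-monoʳ-≤ n (+-monoˡ-≤ Y (^-monoʳ-≤ (suc n) k'≤)) ⟩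
  n * (Y + Y)                               <⟨ *-monoˡ-< (Y + Y) {{Y+Y≢0}} (n<1+n n) ⟩
  suc n * (Y + Y)                           ≡⟨ twice (suc n) Y ⟩
  2 * suc n ^ suc (2 * k' + 1)              ≤⟨ *-monoʳ-≤ 2 (^-monoˡ-≤ (suc (2 * k' + 1)) n+1≤4^ℓ) ⟩
  2 * (2 ^ (2 * ℓ)) ^ suc (2 * k' + 1)      ≡⟨ cong (2 *_) (^-*-assoc 2 (2 * ℓ) _) ⟩
  2 ^ suc (2 * ℓ * suc (2 * k' + 1))        ≡⟨ cong (2 ^_) (exponent ℓ k') ⟩
  2 ^ (4 * suc k' * ℓ + 1)                  ≤⟨ ^-monoʳ-≤ 2 (+-monoʳ-≤ (4 * suc k' * ℓ) (n≤1+n 1)) ⟩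
  2 ^ (4 * suc k' * ℓ + 2)                  ∎
  where
  open ≤-Reasoning
  Y : ℕ
  Y = suc n ^ (2 * k' + 1)
  Y+Y≢0 : NonZero (Y + Y)
  Y+Y≢0 = >-nonZero (<-≤-trans (m^n>0 (suc n) (2 * k' + 1)) (m≤m+n Y Y))
  k'≤ : k' ≤ 2 * k' + 1
  k'≤ = ≤-trans (m≤m+n k' (k' + 0)) (m≤m+n (2 * k') 1)
  twice : ∀ a y → a * (y + y) ≡ 2 * (a * y)
  twice = solve-∀
  exponent : ∀ ℓ k → suc (2 * ℓ * suc (2 * k + 1)) ≡ 4 * suc k * ℓ + 1
  exponent = solve-∀
  n+1≤4^ℓ : suc n ≤ 2 ^ (2 * ℓ)
  n+1≤4^ℓ = begin
    suc n             ≡⟨ +-comm 1 n ⟩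
    n + 1             ≤⟨ +-mono-≤ n≤2^ℓ (m^n>0 2 ℓ) ⟩
    2 ^ ℓ + 2 ^ ℓ     ≡⟨ cong (2 ^ ℓ +_) (sym (+-identityʳ (2 ^ ℓ))) ⟩
    2 ^ suc ℓ         ≤⟨ ^-monoʳ-≤ 2 (≤-trans (≤-reflexive (+-comm 1 ℓ)) (+-monoʳ-≤ ℓ (≤-trans 1≤ℓ (m≤m+n ℓ 0)))) ⟩
    2 ^ (2 * ℓ)       ∎

size-bound : ∀ k' ℓ → 1 ≤ ℓ → 7 * (128 * (4 * suc k' * ℓ + 2)) * suc (8 * k' + 4) ≤ 43008 * (suc k' * suc k') * ℓ
size-bound k' ℓ 1≤ℓ = begin
  7 * (128 * (4 * k * ℓ + 2)) * suc (8 * k' + 4) ≤⟨ *-mono-≤ (*-monoʳ-≤ 7 (*-monoʳ-≤ 128 J≤6kℓ)) q≤8k ⟩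
  7 * (128 * (6 * k * ℓ)) * (8 * k)              ≡⟨ collect k ℓ ⟩
  43008 * (k * k) * ℓ                            ∎
  where
  open ≤-Reasoning
  k : ℕ
  k = suc k'
  J≤6kℓ : 4 * k * ℓ + 2 ≤ 6 * k * ℓ
  J≤6kℓ = begin
    4 * k * ℓ + 2            ≤⟨ +-monoʳ-≤ (4 * k * ℓ) (*-monoʳ-≤ 2 (*-mono-≤ {1} {k} (s≤s z≤n) 1≤ℓ)) ⟩
    4 * k * ℓ + 2 * (k * ℓ)  ≡⟨ six k ℓ ⟩
    6 * k * ℓ                ∎
    where
    six : ∀ k ℓ → 4 * k * ℓ + 2 * (k * ℓ) ≡ 6 * k * ℓ
    six = solve-∀
  q≤8k : suc (8 * k' + 4) ≤ 8 * k
  q≤8k = ≤-trans (≤-reflexive (q≡ k')) (≤-trans (m≤m+n (8 * k' + 5) 3) (≤-reflexive (8k≡ k')))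
    where
    q≡ : ∀ k → suc (8 * k + 4) ≡ 8 * k + 5
    q≡ = solve-∀
    8k≡ : ∀ k → 8 * k + 5 + 3 ≡ 8 * suc k
    8k≡ = solve-∀
  collect : ∀ k ℓ → 7 * (128 * (6 * k * ℓ)) * (8 * k) ≡ 43008 * (k * k) * ℓ
  collect = solve-∀

distinguisher-exists : ∀ n k ℓ → 1 ≤ ℓ → n ≤ 2 ^ ℓ → 1 ≤ k →
  ∃ λ m → Σ (Fin m → Subset n) (λ S → IsDistinguisher k S × m ≤ 43008 * (k * k) * ℓ)
distinguisher-exists n (suc k') ℓ 1≤ℓ n≤2^ℓ _ = from-good (good-exists (tests-fit n ℓ k' n≤2^ℓ 1≤ℓ))
  where
  open Construction n k' (4 * suc k' * ℓ + 2)
  from-good : Σ Family Good →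
    ∃ λ m → Σ (Fin m → Subset n) (λ S → IsDistinguisher (suc k') S × m ≤ 43008 * (suc k' * suc k') * ℓ)
  from-good (H , good) = 7 * M * suc p , lookup (classes H) ,
    (suc (2 * (6 * M)) , good⇒distinguisher H good) , size-bound k' ℓ 1≤ℓ

theorem4 : ∃ λ (C : ℕ) → C > 0 × ((n k : ℕ) → 2 ≤ n → 1 ≤ k → 2 * k ≤ n →
    ∃ λ (m : ℕ) → Σ (Fin m → Subset n) (λ S →
    IsDistinguisher k S × m ≤ C * (k * k) * ⌈log₂ n ⌉))
theorem4 = 43008 , s≤s z≤n , λ n k 2≤n 1≤k _ →
  distinguisher-exists n k ⌈log₂ n ⌉ (⌈log₂⌉-mono-≤ 2≤n) (n≤2^⌈log₂n⌉ n) 1≤k
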